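{- For all integers $n\ge 3$ and $K\ge 1$, the $C_n$ snake with $K$ blocks is a difference graph.
   Context: A graph $G=(V,E)$ is a difference graph if there is a bijection $f$ from $V$ onto a set $S$ of positive integers such that for all distinct $x,y\in V$: $xy\in E$ if and only if $|f(x)-f(y)|\in S$. The $C_n$ snake with $K$ blocks is obtained from a path on $K+1$ vertices by replacing each edge by a cycle $C_n$ (consecutive cycles share exactly one vertex). Explicitly: vertices $u_0,u_1,\dots,u_{K(n-1)}$, with edges $u_iu_{i+1}$ for $0\le i<K(n-1)$ and $u_{k(n-1)}u_{(k+1)(n-1)}$ for $0\le k\le K-1$. -}

module Defs where

open import Data.Nat using (ℕ; zero; suc; _+_; _*_; _∸_; _<_; _≤_; ∣_-_∣)
open import Data.Fin using (Fin; toℕ)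
open import Data.Product using (Σ; ∃; _×_; _,_)
open import Data.Sum using (_⊎_)
open import Relation.Binary.PropositionalEquality using (_≡_; _≢_)
open import Relation.Nullary using (¬_)
open import Function.Bundles using (_⇔_)
open import Function.Definitions using (Injective)

record Graph : Set₁ where
  field
    N   : ℕ
    Adj : Fin N → Fin N → Set

-- Difference graph: a bijection f from V onto a set S of positive integers
-- (S is the image of f) such that for distinct x y:
--   xy ∈ E  iff  |f x - f y| ∈ S.
IsDifferenceGraph : Graph → Set
IsDifferenceGraph G =
  Σ (Fin N → ℕ) λ f →
      Injective _≡_ _≡_ f
    × (∀ x → 0 < f x)
    × (∀ x y → x ≢ y → (Adj x y ⇔ (∃ λ z → f z ≡ ∣ f x - f y ∣)))
  where open Graph G

-- Edge relation of the C_n snake with K blocks on labels u_0 … u_{K(n-1)}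
-- (as natural-number indices): u_i u_{i+1}, and u_{k(n-1)} u_{(k+1)(n-1)} for k < K.
SnakeEdge : ℕ → ℕ → ℕ → ℕ → Set
SnakeEdge n K i j =
    (j ≡ suc i × j ≤ K * (n ∸ 1))
  ⊎ (∃ λ k → k < K × i ≡ k * (n ∸ 1) × j ≡ suc k * (n ∸ 1))

Snake : ℕ → ℕ → Graph
Snake n K = record
  { N   = suc (K * (n ∸ 1))
  ; Adj = λ x y → SnakeEdge n K (toℕ x) (toℕ y) ⊎ SnakeEdge n K (toℕ y) (toℕ x)
  }

module Submission where

-- Write m = n − 1 and label the vertex u_{i + k m} (0 ≤ i < m) by c^k 2^i, where c = 2^(m−1) + 1.
-- Every label is its predecessor plus an earlier label (doubling inside a cycle, and
-- c^(k+1) = c^k 2^(m−1) + c^k at the vertex shared by two cycles), so each edge difference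
-- is a label.  Conversely the labels grow so fast that label x + label z = label t with x < t
-- forces t = x + 1, or x = k m and t = (k+1) m, which is exactly the edge set of the snake.

open import Defs
open import Data.Nat using (ℕ; zero; suc; _+_; _*_; _^_; _<_; _≤_; ∣_-_∣; z≤n; s≤s; >-nonZero)
open import Data.Nat.Properties
open import Data.Nat.DivMod
open import Data.Nat.Divisibility using (n∣m*n)
open import Data.Nat.Solver using (module +-*-Solver)
open import Data.Fin using (Fin; toℕ; fromℕ<)
open import Data.Fin.Properties using (toℕ-injective; toℕ<n; toℕ-fromℕ<)
open import Data.Product using (∃; ∃-syntax; _×_; _,_)
open import Data.Sum using (_⊎_; inj₁; inj₂)
open import Data.Empty using (⊥-elim)
open import Function.Bundles using (_⇔_; mk⇔)
open import Relation.Binary.Definitions using (tri<; tri≈; tri>)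
open import Relation.Binary.PropositionalEquality

m+n≡o⇒n≡∣m-o∣ : ∀ {m n o} → m + n ≡ o → n ≡ ∣ m - o ∣
m+n≡o⇒n≡∣m-o∣ {m} {n} refl = sym (∣m-m+n∣≡n m n)

m≤o⇒n≡∣m-o∣⇒m+n≡o : ∀ {m n o} → m ≤ o → n ≡ ∣ m - o ∣ → m + n ≡ o
m≤o⇒n≡∣m-o∣⇒m+n≡o {m} m≤o refl = trans (cong (m +_) (m≤n⇒∣m-n∣≡n∸m m≤o)) (m+[n∸m]≡n m≤o)

module AdditiveChain (F : ℕ → ℕ) (F-pos : ∀ t → 0 < F t)
                     (F-suc : ∀ s → ∃[ w ] w ≤ s × F (suc s) ≡ F s + F w) where

  F-<-suc : ∀ s → F s < F (suc s)
  F-<-suc s with F-suc s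
  ... | w , _ , eq = subst (F s <_) (sym eq) (m<m+n (F s) (F-pos w))

  F-mono-< : ∀ {a b} → a < b → F a < F b
  F-mono-< {a} {suc b} (s≤s a≤b) with m≤n⇒m<n∨m≡n a≤b
  ... | inj₁ a<b  = <-trans (F-mono-< a<b) (F-<-suc b)
  ... | inj₂ refl = F-<-suc a

  F-mono-≤ : ∀ {a b} → a ≤ b → F a ≤ F b
  F-mono-≤ a≤b with m≤n⇒m<n∨m≡n a≤b
  ... | inj₁ a<b  = <⇒≤ (F-mono-< a<b)
  ... | inj₂ refl = ≤-refl

  F-injective : ∀ {a b} → F a ≡ F b → a ≡ b
  F-injective {a} {b} eq with <-cmp a b
  ... | tri< a<b _ _ = ⊥-elim (<-irrefl eq (F-mono-< a<b))
  ... | tri≈ _ a≡b _ = a≡b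
  ... | tri> _ _ b<a = ⊥-elim (<-irrefl (sym eq) (F-mono-< b<a))

  F-summand-< : ∀ {x z t} → F x + F z ≡ F t → z < t
  F-summand-< {x} {z} {t} eq = ≰⇒> λ t≤z →
    <-irrefl (sym eq) (≤-<-trans (F-mono-≤ t≤z) (m<n+m (F z) (F-pos x)))

module SnakeLabelling (p : ℕ) where

  m : ℕ
  m = suc (suc p)

  c : ℕ
  c = 2 ^ suc p + 1

  -- Opaque so that unification never unfolds _/_ and _%_ and can invert label x + label z.
  opaque
    label : ℕ → ℕ
    label t = c ^ (t / m) * 2 ^ (t % m)

    label-block : ∀ k {i} → i < m → label (i + k * m) ≡ c ^ k * 2 ^ i
    label-block k {i} i<m = cong₂ (λ a b → c ^ a * 2 ^ b) quotient remainder
      where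
      remainder : (i + k * m) % m ≡ i
      remainder = trans ([m+kn]%n≡m%n i k m) (m<n⇒m%n≡m i<m)
      quotient : (i + k * m) / m ≡ k
      quotient = trans (+-distrib-/-∣ʳ i (n∣m*n k)) (cong₂ _+_ (m<n⇒m/n≡0 i<m) (m*n/n≡m k m))

    label-pos : ∀ t → 0 < label t
    label-pos t = *-mono-≤ (m^n>0 c {{>-nonZero (m≤n+m 1 (2 ^ suc p))}} (t / m)) (m^n>0 2 (t % m))

  open +-*-Solver

  label-double : ∀ k {i} → suc i < m → label (suc (i + k * m)) ≡ label (i + k * m) + label (i + k * m)
  label-double k {i} 1+i<m = begin
      label (suc i + k * m)         ≡⟨ label-block k 1+i<m ⟩
      c ^ k * (2 * 2 ^ i)           ≡⟨ solve 2 (λ x y → x :* (con 2 :* y) := x :* y :+ x :* y) refl (c ^ k) (2 ^ i) ⟩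
      c ^ k * 2 ^ i + c ^ k * 2 ^ i ≡⟨ sym (cong₂ _+_ (label-block k i<m) (label-block k i<m)) ⟩
      label (i + k * m) + label (i + k * m) ∎
    where
    open ≡-Reasoning
    i<m : i < m
    i<m = <-trans (n<1+n i) 1+i<m

  label-wrap : ∀ k → label (suc (suc p + k * m)) ≡ label (suc p + k * m) + label (k * m)
  label-wrap k = begin
      label (0 + suc k * m)             ≡⟨ label-block (suc k) (s≤s z≤n) ⟩
      c * c ^ k * 1                     ≡⟨ solve 2 (λ x y → ((y :+ con 1) :* x) :* con 1 := x :* y :+ x :* con 1) refl (c ^ k) (2 ^ suc p) ⟩
      c ^ k * 2 ^ suc p + c ^ k * 1     ≡⟨ sym (cong₂ _+_ (label-block k ≤-refl) (label-block k (s≤s z≤n))) ⟩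
      label (suc p + k * m) + label (0 + k * m) ∎
    where open ≡-Reasoning

  label-chord : ∀ k → label (suc k * m) ≡ label (k * m) + label (suc p + k * m)
  label-chord k = trans (label-wrap k) (+-comm (label (suc p + k * m)) (label (k * m)))

  data Position : ℕ → Set where
    inner : ∀ k i → suc i < m → Position (i + k * m)
    last  : ∀ k → Position (suc p + k * m)

  position : ∀ s → Position s
  position s = subst Position (sym (m≡m%n+[m/n]*n s m)) (position-in-block (s / m) (m%n<n s m))
    where
    position-in-block : ∀ k {i} → i < m → Position (i + k * m)
    position-in-block k {i} (s≤s i≤1+p) with m≤n⇒m<n∨m≡n i≤1+p
    ... | inj₁ i<1+p = inner k i (s≤s i<1+p)
    ... | inj₂ refl  = last k

  label-suc : ∀ s → ∃[ w ] w ≤ s × label (suc s) ≡ label s + label w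
  label-suc s with position s
  label-suc .(i + k * m)      | inner k i 1+i<m = i + k * m , ≤-refl , label-double k 1+i<m
  label-suc .(suc p + k * m)  | last k          = k * m , m≤n+m (k * m) (suc p) , label-wrap k

  open AdditiveChain label label-pos label-suc public

  nonconsecutive-label-sum : ∀ {x z s} → Position s → x < s → z ≤ s →
                             label x + label z ≡ label (suc s) → ∃[ k ] x ≡ k * m × suc s ≡ suc k * m
  nonconsecutive-label-sum (inner k i 1+i<m) x<s z≤s eq =
    ⊥-elim (<-irrefl (trans eq (label-double k 1+i<m)) (+-mono-<-≤ (F-mono-< x<s) (F-mono-≤ z≤s)))
  nonconsecutive-label-sum {x} {z} (last k) x<s z≤s eq with <-cmp x (k * m)
  ... | tri< x<km _ _ = ⊥-elim (<-irrefl (trans eq (label-chord k))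
                                         (+-mono-<-≤ (F-mono-< x<km) (F-mono-≤ z≤s)))
  ... | tri≈ _ refl _ = k , refl , refl
  ... | tri> _ _ km<x with m≤n⇒m<n∨m≡n z≤s
  ...   | inj₂ refl = ⊥-elim (<-irrefl (sym (trans eq (label-chord k)))
                                      (+-mono-<-≤ (F-mono-< km<x) ≤-refl))
  ...   | inj₁ (s≤s z≤r) = ⊥-elim (<-irrefl eq (begin-strict
      label x + label z                         ≤⟨ +-mono-≤ (F-mono-≤ (≤-pred x<s)) (F-mono-≤ z≤r) ⟩
      label (p + k * m) + label (p + k * m)     ≡⟨ label-double k ≤-refl ⟨
      label (suc p + k * m)                     <⟨ m<m+n _ (label-pos (k * m)) ⟩
      label (suc p + k * m) + label (k * m)     ≡⟨ label-wrap k ⟨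
      label (suc (suc p + k * m))               ∎))
    where open ≤-Reasoning

  label-sum⇒consecutive-or-chord : ∀ {x z t} → x < t → label x + label z ≡ label t →
                                   t ≡ suc x ⊎ ∃[ k ] x ≡ k * m × t ≡ suc k * m
  label-sum⇒consecutive-or-chord {t = suc s} (s≤s x≤s) eq with m≤n⇒m<n∨m≡n x≤s
  ... | inj₂ refl = inj₁ refl
  ... | inj₁ x<s  = inj₂ (nonconsecutive-label-sum (position s) x<s (≤-pred (F-summand-< eq)) eq)

  module _ (K : ℕ) where

    Edge : ℕ → ℕ → Set
    Edge = SnakeEdge (suc m) K

    edge⇒label-sum : ∀ {i j} → Edge i j → ∃[ z ] z < j × label i + label z ≡ label j
    edge⇒label-sum {i} (inj₁ (refl , _)) with label-suc i
    ... | w , w≤i , eq = w , s≤s w≤i , sym eq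
    edge⇒label-sum (inj₂ (k , _ , refl , refl)) =
      suc p + k * m , n<1+n _ , sym (label-chord k)

    label-sum⇒edge : ∀ {i j z} → i < j → j ≤ K * m → label i + label z ≡ label j → Edge i j
    label-sum⇒edge i<j j≤Km eq with label-sum⇒consecutive-or-chord i<j eq
    ... | inj₁ refl = inj₁ (refl , j≤Km)
    ... | inj₂ (k , refl , refl) = inj₂ (k , *-cancelʳ-≤ (suc k) K m j≤Km , refl , refl)

    f : Fin (suc (K * m)) → ℕ
    f x = label (toℕ x)

    edge⇒labelled-difference : ∀ {i j} → j < suc (K * m) → Edge i j →
                               ∃ λ z → f z ≡ ∣ label i - label j ∣
    edge⇒labelled-difference j<N e with edge⇒label-sum e
    ... | z , z<j , eq = fromℕ< (<-trans z<j j<N) ,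
                         trans (cong label (toℕ-fromℕ< (<-trans z<j j<N))) (m+n≡o⇒n≡∣m-o∣ eq)

    adjacent⇔labelled-difference : ∀ x y → x ≢ y →
      Graph.Adj (Snake (suc m) K) x y ⇔ (∃ λ z → f z ≡ ∣ f x - f y ∣)
    adjacent⇔labelled-difference x y x≢y = mk⇔ to from
      where
      to : Graph.Adj (Snake (suc m) K) x y → ∃ λ z → f z ≡ ∣ f x - f y ∣
      to (inj₁ e) = edge⇒labelled-difference (toℕ<n y) e
      to (inj₂ e) with edge⇒labelled-difference (toℕ<n x) e
      ... | z , eq = z , trans eq (∣-∣-comm (f y) (f x))
      from : (∃ λ z → f z ≡ ∣ f x - f y ∣) → Graph.Adj (Snake (suc m) K) x y
      from (z , eq) with <-cmp (toℕ x) (toℕ y)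
      ... | tri< x<y _ _ = inj₁ (label-sum⇒edge x<y (≤-pred (toℕ<n y))
                                   (m≤o⇒n≡∣m-o∣⇒m+n≡o (F-mono-≤ (<⇒≤ x<y)) eq))
      ... | tri≈ _ x≡y _ = ⊥-elim (x≢y (toℕ-injective x≡y))
      ... | tri> _ _ y<x = inj₂ (label-sum⇒edge y<x (≤-pred (toℕ<n x))
                                   (m≤o⇒n≡∣m-o∣⇒m+n≡o (F-mono-≤ (<⇒≤ y<x)) (trans eq (∣-∣-comm (f x) (f y)))))

    snake-isDifferenceGraph : IsDifferenceGraph (Snake (suc m) K)
    snake-isDifferenceGraph =
      f , (λ eq → toℕ-injective (F-injective eq)) , (λ x → label-pos (toℕ x)) , adjacent⇔labelled-difference

theorem3p8 : (n K : ℕ) → 3 ≤ n → 1 ≤ K → IsDifferenceGraph (Snake n K)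
theorem3p8 (suc (suc (suc p))) K _ _ = SnakeLabelling.snake-isDifferenceGraph p K
theorem3p8 (suc zero) K (s≤s ()) _
theorem3p8 (suc (suc zero)) K (s≤s (s≤s ())) _
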